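{- Every geodesic in $Y_{n,m}$ ending at the vertex $0$ has a wall.
   Context: For integers $n\geq 1$, $m\geq 0$, the Yoke graph $Y_{n,m}$ has vertices the tuples $v=(v_0,\dots,v_{m+1})$ with $v_0,v_{m+1}\in\mathbb{Z}_n$, $v_1,\dots,v_m\in\{0,1\}$ and $\sum v_i\equiv0\pmod n$; $0$ is the all-zero vertex. An edge from $x$ to $y$ is a left shift at position $i$ ($0\leq i\leq m$) if $y_j=x_j$ for $j\notin\{i,i+1\}$, $y_i=x_i+1$, $y_{i+1}=x_{i+1}-1$, and a right shift at $i$ if $y_i=x_i-1$, $y_{i+1}=x_{i+1}+1$ (bucket coordinates in $\mathbb{Z}_n$; entries staying in allowed sets); these are exactly the edges. For a path $P$ from $v$ to $0$: an integer $0\leq p\leq m$ is an inner wall of $P$ if no step of $P$ is a shift (in either direction) at position $p$; $-1$ is a wall of $P$ if no step of $P$ is a left shift at position $0$; $m+1$ is a wall of $P$ if no step of $P$ is a right shift at position $m$. A wall is an inner wall or one of these outer walls. -}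

module Defs where

open import Data.Nat using (ℕ; zero; suc; _<_; _≤_)
open import Data.Nat.Divisibility using (_∣_)
open import Data.Fin using (Fin; toℕ; inject₁; fromℕ) renaming (zero to fzero; suc to fsuc)
open import Data.Vec using (Vec; lookup; replicate; toList)
open import Data.List using (List; []; _∷_; length)
open import Data.Nat.ListAction using (sum)
open import Data.List.Relation.Unary.All using (All)
open import Data.Product using (_×_; _,_; ∃)
open import Data.Sum using (_⊎_)
open import Relation.Binary.PropositionalEquality using (_≡_; _≢_)
open import Relation.Nullary using (¬_)

-- A vertex of Y_{n,m} is encoded as a vector (v_0, …, v_{m+1}) of naturals:
-- the bucket coordinates v_0, v_{m+1} represent elements of ℤ_n by their
-- representatives in {0,…,n-1}; inner coordinates lie in {0,1}.
Coords : ℕ → Set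
Coords m = Vec ℕ (suc (suc m))

IsBucket : (m : ℕ) → Fin (suc (suc m)) → Set
IsBucket m j = (toℕ j ≡ 0) ⊎ (toℕ j ≡ suc m)

Valid : (n m : ℕ) → Coords m → Set
Valid n m x =
  (lookup x fzero < n) ×
  (lookup x (fromℕ (suc m)) < n) ×
  (∀ j → ¬ IsBucket m j → lookup x j ≤ 1) ×
  (n ∣ sum (toList x))

IncMod : ℕ → ℕ → ℕ → Set
IncMod n a b = (suc a < n × b ≡ suc a) ⊎ (suc a ≡ n × b ≡ 0)

Inc : (n m : ℕ) → Fin (suc (suc m)) → ℕ → ℕ → Set
Inc n m j a b = (IsBucket m j × IncMod n a b) ⊎ (¬ IsBucket m j × b ≡ suc a)

data Dir : Set where
  left right : Dir

OthersEq : (m : ℕ) → Fin (suc m) → Coords m → Coords m → Set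
OthersEq m i x y = ∀ j → j ≢ inject₁ i → j ≢ fsuc i → lookup y j ≡ lookup x j

Shift : (n m : ℕ) → Dir → Fin (suc m) → Coords m → Coords m → Set
Shift n m left i x y =
  Inc n m (inject₁ i) (lookup x (inject₁ i)) (lookup y (inject₁ i)) ×
  Inc n m (fsuc i) (lookup y (fsuc i)) (lookup x (fsuc i)) ×
  OthersEq m i x y
Shift n m right i x y =
  Inc n m (inject₁ i) (lookup y (inject₁ i)) (lookup x (inject₁ i)) ×
  Inc n m (fsuc i) (lookup x (fsuc i)) (lookup y (fsuc i)) ×
  OthersEq m i x y

zeroV : (m : ℕ) → Coords m
zeroV m = replicate _ 0

-- paths in Y_{n,m}: every vertex reached is a vertex of Y_{n,m}
-- (the start vertex's validity is assumed separately)
data Path (n m : ℕ) : Coords m → Coords m → Set where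
  []   : ∀ {x} → Path n m x x
  step : ∀ {x y z} (d : Dir) (i : Fin (suc m)) →
         Valid n m y → Shift n m d i x y → Path n m y z → Path n m x z

len : ∀ {n m x y} → Path n m x y → ℕ
len []                 = 0
len (step _ _ _ _ p)   = suc (len p)

labels : ∀ {n m x y} → Path n m x y → List (Dir × Fin (suc m))
labels []                 = []
labels (step d i _ _ p)   = (d , i) ∷ labels p

Geodesic : ∀ {n m v w} → Path n m v w → Set
Geodesic {n} {m} {v} {w} P = ∀ (Q : Path n m v w) → len P ≤ len Q

InnerWall : ∀ {n m x y} → Path n m x y → Fin (suc m) → Set
InnerWall P p = All (λ { (d , i) → i ≢ p }) (labels P)

LowerWall : ∀ {n m x y} → Path n m x y → Set
LowerWall P = All (λ { (d , i) → ¬ (d ≡ left × i ≡ fzero) }) (labels P)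

UpperWall : ∀ {n m x y} → Path n m x y → Set
UpperWall {m = m} P = All (λ { (d , i) → ¬ (d ≡ right × i ≡ fromℕ m) }) (labels P)

HasWall : ∀ {n m x y} → Path n m x y → Set
HasWall P = (∃ λ p → InnerWall P p) ⊎ LowerWall P ⊎ UpperWall P

module Submission where

-- A path P to 0 has a net flow: flow P k is the number of right shifts at position k minus the
-- number of left shifts there.  Moving flow P k units across every position k turns the start
-- vertex into 0 (modulo n in the two buckets); we say the flow drains it.  Conversely, a flow F
-- draining a vertex x can be realised by a path of length Σₖ |F k|: across an inner coordinate
-- F can only grow, so whenever F ≠ 0 some single shift in the direction of F is possible, and it
-- lowers Σₖ |F k| by one.  Hence a geodesic shifts in one direction only at every position.
-- Without a wall it would shift left at 0; and if it shifts only left at k and uses k+1, it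
-- shifts only left at k+1, since otherwise coordinate k+1 would have to supply two units.
-- So it never shifts right at m, and m+1 is a wall after all.

open import Defs
open import Function using (_∘_)
open import Data.Nat as ℕ using (ℕ; zero; suc; _+_; _≤_; _<_; z≤n; s≤s; z<s; s<s; _≟_)
import Data.Nat.Properties as ℕ
open import Data.Nat.Divisibility as ℕ∣ using (_∣_)
open import Data.Nat.ListAction using (sum)
import Data.Nat.Tactic.RingSolver as ℕ-Solver
open import Data.Integer as ℤ using (ℤ; +_; +[1+_]; -[1+_]; 0ℤ; 1ℤ; -1ℤ; ∣_∣)
import Data.Integer.Properties as ℤ
import Data.Integer.Divisibility.Signed as ℤ∣
open import Data.Integer.Tactic.RingSolver using (solve-∀)
open import Data.Fin using (Fin; toℕ; inject₁; fromℕ<) renaming (zero to fzero; suc to fsuc)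
import Data.Fin.Properties as Fin
open import Data.Vec using (Vec; []; _∷_; lookup; replicate; toList)
open import Data.Product using (Σ; _×_; _,_; proj₁; proj₂)
open import Data.Sum using (_⊎_; inj₁; inj₂)
open import Data.List.Relation.Unary.All as All using (All; []; _∷_)
open import Relation.Binary.PropositionalEquality hiding (J)
open import Relation.Nullary using (¬_; Dec; yes; no; contradiction)
open import Relation.Nullary.Decidable using (_⊎-dec_)

-- Out of range, at returns the junk value 0.
at : ∀ {N} → Vec ℕ N → ℕ → ℕ
at []      _       = 0
at (a ∷ _) zero    = a
at (_ ∷ v) (suc j) = at v j

lookup≡at : ∀ {N} (v : Vec ℕ N) {J : Fin N} {j} → toℕ J ≡ j → lookup v J ≡ at v j
lookup≡at (_ ∷ _) {fzero}  refl = refl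
lookup≡at (_ ∷ v) {fsuc J} refl = lookup≡at v refl

setAt : ∀ {N} → Vec ℕ N → ℕ → ℕ → Vec ℕ N
setAt []      _       _ = []
setAt (_ ∷ v) zero    a = a ∷ v
setAt (b ∷ v) (suc k) a = b ∷ setAt v k a

at-setAt-≡ : ∀ {N} (v : Vec ℕ N) {k} a → k < N → at (setAt v k a) k ≡ a
at-setAt-≡ (_ ∷ _) {zero}  a _         = refl
at-setAt-≡ (_ ∷ v) {suc k} a (s<s k<N) = at-setAt-≡ v a k<N

at-setAt-≢ : ∀ {N} (v : Vec ℕ N) {k} a {j} → j ≢ k → at (setAt v k a) j ≡ at v j
at-setAt-≢ []      _ _ = refl
at-setAt-≢ (_ ∷ _) {zero}  a {zero}  j≢k = contradiction refl j≢k
at-setAt-≢ (_ ∷ _) {zero}  a {suc j} _   = refl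
at-setAt-≢ (_ ∷ _) {suc k} a {zero}  _   = refl
at-setAt-≢ (_ ∷ v) {suc k} a {suc j} j≢k = at-setAt-≢ v a (j≢k ∘ cong suc)

at-injective : ∀ {N} (v w : Vec ℕ N) → (∀ j → j < N → at v j ≡ at w j) → v ≡ w
at-injective []      []      _  = refl
at-injective (a ∷ v) (b ∷ w) eq = cong₂ _∷_ (eq 0 z<s) (at-injective v w (λ j → eq (suc j) ∘ s<s))

at-replicate : ∀ N j → at (replicate N 0) j ≡ 0
at-replicate zero    _       = refl
at-replicate (suc N) zero    = refl
at-replicate (suc N) (suc j) = at-replicate N j

sumℕ : ℕ → (ℕ → ℕ) → ℕ
sumℕ zero    f = 0
sumℕ (suc N) f = f 0 + sumℕ N (f ∘ suc)

syntax sumℕ N (λ j → e) = ∑[ j < N ] e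

sumℤ : ℕ → (ℕ → ℤ) → ℤ
sumℤ zero    f = 0ℤ
sumℤ (suc N) f = f 0 ℤ.+ sumℤ N (f ∘ suc)

syntax sumℤ N (λ j → e) = ∑ᶻ[ j < N ] e

sumℕ-cong : ∀ N {f g} → (∀ j → j < N → f j ≡ g j) → sumℕ N f ≡ sumℕ N g
sumℕ-cong zero    _  = refl
sumℕ-cong (suc N) eq = cong₂ _+_ (eq 0 z<s) (sumℕ-cong N (λ j → eq (suc j) ∘ s<s))

sumℕ-+ : ∀ N f g → ∑[ j < N ] (f j + g j) ≡ sumℕ N f + sumℕ N g
sumℕ-+ zero    f g = refl
sumℕ-+ (suc N) f g rewrite sumℕ-+ N (f ∘ suc) (g ∘ suc) = interchange (f 0) (g 0) _ _
  where
  interchange : ∀ a b c d → a + b + (c + d) ≡ a + c + (b + d)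
  interchange = ℕ-Solver.solve-∀

sumℕ-zero : ∀ N → ∑[ j < N ] 0 ≡ 0
sumℕ-zero zero    = refl
sumℕ-zero (suc N) = sumℕ-zero N

sumℕ-update : ∀ N f g {k} → k < N → (∀ j → j ≢ k → g j ≡ f j) →
              sumℕ N g + f k ≡ sumℕ N f + g k
sumℕ-update (suc N) f g {zero} _ eq
  rewrite sumℕ-cong N {g ∘ suc} {f ∘ suc} (λ j _ → eq (suc j) λ ()) = swap (g 0) _ (f 0)
  where
  swap : ∀ a s b → a + s + b ≡ b + s + a
  swap = ℕ-Solver.solve-∀
sumℕ-update (suc N) f g {suc k} (s<s k<N) eq = begin
  g 0 + sumℕ N (g ∘ suc) + f (suc k)   ≡⟨ cong (λ a → a + _ + _) (eq 0 λ ()) ⟩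
  f 0 + sumℕ N (g ∘ suc) + f (suc k)   ≡⟨ ℕ.+-assoc (f 0) _ _ ⟩
  f 0 + (sumℕ N (g ∘ suc) + f (suc k)) ≡⟨ cong (_+_ (f 0)) (sumℕ-update N (f ∘ suc) (g ∘ suc) k<N eq′) ⟩
  f 0 + (sumℕ N (f ∘ suc) + g (suc k)) ≡⟨ ℕ.+-assoc (f 0) _ _ ⟨
  f 0 + sumℕ N (f ∘ suc) + g (suc k)   ∎
  where
  open ≡-Reasoning
  eq′ : ∀ j → j ≢ k → g (suc j) ≡ f (suc j)
  eq′ j j≢k = eq (suc j) (j≢k ∘ ℕ.suc-injective)

sumℕ-mono-≤ : ∀ N {f g} → (∀ j → j < N → f j ≤ g j) → sumℕ N f ≤ sumℕ N g
sumℕ-mono-≤ zero    _  = z≤n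
sumℕ-mono-≤ (suc N) le = ℕ.+-mono-≤ (le 0 z<s) (sumℕ-mono-≤ N (λ j → le (suc j) ∘ s<s))

sumℕ-mono-< : ∀ N {f g} → (∀ j → j < N → f j ≤ g j) → ∀ {k} → k < N → f k < g k →
              sumℕ N f < sumℕ N g
sumℕ-mono-< (suc N) le {zero}  _         lt = ℕ.+-mono-<-≤ lt (sumℕ-mono-≤ N (λ j → le (suc j) ∘ s<s))
sumℕ-mono-< (suc N) le {suc k} (s<s k<N) lt =
  ℕ.+-mono-≤-< (le 0 z<s) (sumℕ-mono-< N (λ j → le (suc j) ∘ s<s) k<N lt)

sumℕ≡0⇒ : ∀ N f → sumℕ N f ≡ 0 → ∀ j → j < N → f j ≡ 0
sumℕ≡0⇒ (suc N) f eq zero    _         = ℕ.m+n≡0⇒m≡0 (f 0) eq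
sumℕ≡0⇒ (suc N) f eq (suc j) (s<s j<N) = sumℕ≡0⇒ N (f ∘ suc) (ℕ.m+n≡0⇒n≡0 (f 0) eq) j j<N

sum-toList : ∀ {N} (v : Vec ℕ N) → sum (toList v) ≡ sumℕ N (at v)
sum-toList []      = refl
sum-toList (a ∷ v) = cong (_+_ a) (sum-toList v)

+-sumℕ : ∀ N f → + sumℕ N f ≡ ∑ᶻ[ j < N ] (+ f j)
+-sumℕ zero    f = refl
+-sumℕ (suc N) f = trans (ℤ.pos-+ (f 0) _) (cong (ℤ._+_ (+ f 0)) (+-sumℕ N (f ∘ suc)))

sumℤ-+ : ∀ N f g → ∑ᶻ[ j < N ] (f j ℤ.+ g j) ≡ sumℤ N f ℤ.+ sumℤ N g
sumℤ-+ zero    f g = refl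
sumℤ-+ (suc N) f g rewrite sumℤ-+ N (f ∘ suc) (g ∘ suc) = interchange (f 0) (g 0) _ _
  where
  interchange : ∀ a b c d → a ℤ.+ b ℤ.+ (c ℤ.+ d) ≡ a ℤ.+ c ℤ.+ (b ℤ.+ d)
  interchange = solve-∀

sumℤ-telescope : ∀ N (f : ℕ → ℤ) → ∑ᶻ[ j < N ] (f j ℤ.- f (suc j)) ≡ f 0 ℤ.- f N
sumℤ-telescope zero    f = sym (ℤ.+-inverseʳ (f 0))
sumℤ-telescope (suc N) f rewrite sumℤ-telescope N (f ∘ suc) = cancel (f 0) (f 1) (f (suc N))
  where
  cancel : ∀ a b c → a ℤ.- b ℤ.+ (b ℤ.- c) ≡ a ℤ.- c
  cancel = solve-∀

∣-sumℤ : ∀ {d} N f → (∀ j → j < N → d ℤ∣.∣ f j) → d ℤ∣.∣ sumℤ N f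
∣-sumℤ zero    f _   = ℤ∣.divides 0ℤ refl
∣-sumℤ (suc N) f d∣f =
  ℤ∣.∣m∣n⇒∣m+n (d∣f 0 z<s) (∣-sumℤ N (f ∘ suc) (λ j → d∣f (suc j) ∘ s<s))

⟦_≡_⟧ : ℕ → ℕ → ℕ
⟦ j ≡ k ⟧ with j ≟ k
... | yes _ = 1
... | no  _ = 0

⟦≡⟧-refl : ∀ k → ⟦ k ≡ k ⟧ ≡ 1
⟦≡⟧-refl k with k ≟ k
... | yes _   = refl
... | no  k≢k = contradiction refl k≢k

⟦≡⟧-≢ : ∀ {j k} → j ≢ k → ⟦ j ≡ k ⟧ ≡ 0
⟦≡⟧-≢ {j} {k} j≢k with j ≟ k
... | yes j≡k = contradiction j≡k j≢k
... | no  _   = refl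

sumℕ-⟦≡⟧ : ∀ N {k} → k < N → ∑[ j < N ] ⟦ j ≡ k ⟧ ≡ 1
sumℕ-⟦≡⟧ N {k} k<N = begin
  ∑[ j < N ] ⟦ j ≡ k ⟧      ≡⟨ ℕ.+-identityʳ _ ⟨
  ∑[ j < N ] ⟦ j ≡ k ⟧ + 0  ≡⟨ sumℕ-update N (λ _ → 0) (λ j → ⟦ j ≡ k ⟧) k<N (λ _ → ⟦≡⟧-≢) ⟩
  ∑[ j < N ] 0 + ⟦ k ≡ k ⟧  ≡⟨ cong₂ _+_ (sumℕ-zero N) (⟦≡⟧-refl k) ⟩
  1                         ∎
  where open ≡-Reasoning

⟦≡⟧≡0⇒≢ : ∀ {j k} → ⟦ j ≡ k ⟧ ≡ 0 → j ≢ k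
⟦≡⟧≡0⇒≢ {j} ⟦j≡j⟧≡0 refl = ℕ.1+n≢0 (trans (sym (⟦≡⟧-refl j)) ⟦j≡j⟧≡0)

∣∧<⇒≡0 : ∀ {d a} → d ℕ∣.∣ a → a < d → a ≡ 0
∣∧<⇒≡0 {a = zero}  _   _   = refl
∣∧<⇒≡0 {a = suc _} d∣a a<d = contradiction d∣a (ℕ∣.>⇒∤ a<d)

∣r-l∣≤l+r : ∀ r l → ∣ + r ℤ.- + l ∣ ≤ l + r
∣r-l∣≤l+r r l = ℕ.≤-trans (ℤ.∣i+j∣≤∣i∣+∣j∣ (+ r) (ℤ.- + l))
                          (ℕ.≤-reflexive (trans (cong (_+_ r) (ℤ.∣-i∣≡∣i∣ (+ l))) (ℕ.+-comm r l)))

∣r-l∣<l+r : ∀ {r l} → 0 < r → 0 < l → ∣ + r ℤ.- + l ∣ < l + r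
∣r-l∣<l+r {suc r} {suc l} _ _ = begin-strict
  ∣ + suc r ℤ.- + suc l ∣  ≡⟨ cong ∣_∣ (trans (ℤ.[1+m]⊖[1+n]≡m⊖n r l) (sym (ℤ.m-n≡m⊖n r l))) ⟩
  ∣ + r ℤ.- + l ∣          ≤⟨ ∣r-l∣≤l+r r l ⟩
  l + r                    <⟨ ℕ.+-mono-< (ℕ.n<1+n l) (ℕ.n<1+n r) ⟩
  suc l + suc r            ∎
  where open ℕ.≤-Reasoning

+r≡-l+c⇒r+l≡c : ∀ r l c → + r ℤ.- + 0 ≡ + 0 ℤ.- + l ℤ.+ + c → r + l ≡ c
+r≡-l+c⇒r+l≡c r l c r≡c-l = ℤ.+-injective (begin
  + (r + l)                       ≡⟨ ℤ.pos-+ r l ⟩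
  + r ℤ.+ + l                     ≡⟨ pad (+ r) (+ l) ⟩
  (+ r ℤ.- + 0) ℤ.+ + l           ≡⟨ cong (ℤ._+ + l) r≡c-l ⟩
  (+ 0 ℤ.- + l ℤ.+ + c) ℤ.+ + l   ≡⟨ cancel (+ l) (+ c) ⟩
  + c                             ∎)
  where
  open ≡-Reasoning
  pad : ∀ a b → a ℤ.+ b ≡ (a ℤ.- 0ℤ) ℤ.+ b
  pad = solve-∀
  cancel : ∀ b c → (0ℤ ℤ.- b ℤ.+ c) ℤ.+ b ≡ c
  cancel = solve-∀

module Yoke (n′ m : ℕ) where

  n : ℕ
  n = suc n′

  Bucket : ℕ → Set
  Bucket j = j ≡ 0 ⊎ j ≡ suc m

  bucket? : ∀ j → Dec (Bucket j)
  bucket? j = j ≟ 0 ⊎-dec j ≟ suc m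

  ¬Bucket-suc : ∀ {t} → t < m → ¬ Bucket (suc t)
  ¬Bucket-suc t<m (inj₂ t≡m) = ℕ.<-irrefl (ℕ.suc-injective t≡m) t<m

  InRange : ℕ → ℕ → Set
  InRange c a = (Bucket c → a < n) × (¬ Bucket c → a ≤ 1)

  Bounded : Coords m → Set
  Bounded x = ∀ c → c < suc (suc m) → InRange c (at x c)

  valid⇒bounded : ∀ {x} → Valid n m x → Bounded x
  valid⇒bounded {x} (x₀<n , xₘ₊₁<n , inner≤1 , _) c c< = bucket , innerBound
    where
    bucket : Bucket c → at x c < n
    bucket (inj₁ refl) = subst (_< n) (lookup≡at x refl) x₀<n
    bucket (inj₂ refl) = subst (_< n) (lookup≡at x (Fin.toℕ-fromℕ (suc m))) xₘ₊₁<n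
    c≡ = Fin.toℕ-fromℕ< c<
    innerBound : ¬ Bucket c → at x c ≤ 1
    innerBound nb = subst (_≤ 1) (lookup≡at x c≡) (inner≤1 (fromℕ< c<) (nb ∘ subst Bucket c≡))

  bounded⇒valid : ∀ {x} → Bounded x → n ∣ sum (toList x) → Valid n m x
  bounded⇒valid {x} B n∣x =
    subst (_< n) (sym (lookup≡at x refl)) (proj₁ (B 0 z<s) (inj₁ refl)) ,
    subst (_< n) (sym (lookup≡at x (Fin.toℕ-fromℕ (suc m)))) (proj₁ (B (suc m) ℕ.≤-refl) (inj₂ refl)) ,
    (λ J nb → subst (_≤ 1) (sym (lookup≡at x refl)) (proj₂ (B (toℕ J) (Fin.toℕ<n J)) nb)) ,
    n∣x

  -- Vanishing in the group of coordinate j: ℤ/n at the buckets, ℤ at the inner coordinates.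
  Vanishes : ℕ → ℤ → Set
  Vanishes j z = (+ n ℤ∣.∣ z) × (¬ Bucket j → z ≡ 0ℤ)

  vanishes-0 : ∀ {j} → Vanishes j 0ℤ
  vanishes-0 = ℤ∣.divides 0ℤ refl , λ _ → refl

  vanishes-+ : ∀ {j a b} → Vanishes j a → Vanishes j b → Vanishes j (a ℤ.+ b)
  vanishes-+ (n∣a , a≡0) (n∣b , b≡0) =
    ℤ∣.∣m∣n⇒∣m+n n∣a n∣b , λ nb → cong₂ ℤ._+_ (a≡0 nb) (b≡0 nb)

  vanishes-neg : ∀ {j a} → Vanishes j a → Vanishes j (ℤ.- a)
  vanishes-neg (n∣a , a≡0) = ℤ∣.∣m⇒∣-m n∣a , λ nb → cong ℤ.-_ (a≡0 nb)

  inflow : (ℕ → ℤ) → ℕ → ℤ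
  inflow F zero    = 0ℤ
  inflow F (suc j) = F j

  excess : Coords m → (ℕ → ℤ) → ℕ → ℤ
  excess x F j = + at x j ℤ.+ (inflow F j ℤ.- F j)

  -- F k is the net number of units to be moved rightwards across position k; F drains x
  -- when moving them turns every coordinate into 0 (F (suc m) is the outflow of the last bucket).
  record Drains (x : Coords m) (F : ℕ → ℤ) : Set where
    constructor drains
    field
      last-outflow    : F (suc m) ≡ 0ℤ
      excess-vanishes : ∀ j → j < suc (suc m) → Vanishes j (excess x F j)

  drains⇒divisible : ∀ {x F} → Drains x F → n ∣ sum (toList x)
  drains⇒divisible {x} {F} (drains Fₘ₊₁≡0 vanish) =
    ℤ∣.∣⇒∣ᵤ (subst (+ n ℤ∣.∣_) total (∣-sumℤ _ (excess x F) (λ j → proj₁ ∘ vanish j)))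
    where
    open ≡-Reasoning
    xs = ∑ᶻ[ j < suc (suc m) ] (+ at x j)
    total : sumℤ (suc (suc m)) (excess x F) ≡ + sum (toList x)
    total = begin
      sumℤ (suc (suc m)) (excess x F)
        ≡⟨ sumℤ-+ (suc (suc m)) (λ j → + at x j) (λ j → inflow F j ℤ.- F j) ⟩
      ∑ᶻ[ j < suc (suc m) ] (+ at x j) ℤ.+ ∑ᶻ[ j < suc (suc m) ] (inflow F j ℤ.- F j)
        ≡⟨ cong (ℤ._+_ xs) (sumℤ-telescope (suc (suc m)) (inflow F)) ⟩
      ∑ᶻ[ j < suc (suc m) ] (+ at x j) ℤ.+ (0ℤ ℤ.- F (suc m))
        ≡⟨ cong (λ z → xs ℤ.+ (0ℤ ℤ.- z)) Fₘ₊₁≡0 ⟩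
      ∑ᶻ[ j < suc (suc m) ] (+ at x j) ℤ.+ 0ℤ
        ≡⟨ ℤ.+-identityʳ _ ⟩
      ∑ᶻ[ j < suc (suc m) ] (+ at x j)
        ≡⟨ +-sumℕ (suc (suc m)) (at x) ⟨
      + sumℕ (suc (suc m)) (at x)
        ≡⟨ cong +_ (sum-toList x) ⟨
      + sum (toList x) ∎

  sign : Dir → ℤ
  sign right = 1ℤ
  sign left  = -1ℤ

  unit : Dir → ℕ → ℕ → ℤ
  unit right k j = + ⟦ j ≡ k ⟧
  unit left  k j = ℤ.- + ⟦ j ≡ k ⟧

  unit-≢ : ∀ d {k j} → j ≢ k → unit d k j ≡ 0ℤ
  unit-≢ right j≢k = cong +_ (⟦≡⟧-≢ j≢k)
  unit-≢ left  j≢k = cong (ℤ.-_ ∘ +_) (⟦≡⟧-≢ j≢k)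

  unit-self : ∀ d k → unit d k k ≡ sign d
  unit-self right k = cong +_ (⟦≡⟧-refl k)
  unit-self left  k = cong (ℤ.-_ ∘ +_) (⟦≡⟧-refl k)

  unit-beyond : ∀ d (i : Fin (suc m)) → unit d (toℕ i) (suc m) ≡ 0ℤ
  unit-beyond d i = unit-≢ d λ m+1≡i → ℕ.<-irrefl (sym m+1≡i) (Fin.toℕ<n i)

  excess-unit-source : ∀ x d k → excess x (unit d k) k ≡ + at x k ℤ.+ (0ℤ ℤ.- sign d)
  excess-unit-source x d k = cong₂ (λ a b → + at x k ℤ.+ (a ℤ.- b)) (inflow-self k) (unit-self d k)
    where
    inflow-self : ∀ k → inflow (unit d k) k ≡ 0ℤ
    inflow-self zero    = refl
    inflow-self (suc k) = unit-≢ d (ℕ.1+n≢n ∘ sym)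

  excess-unit-target : ∀ x d k → excess x (unit d k) (suc k) ≡ + at x (suc k) ℤ.+ (sign d ℤ.- 0ℤ)
  excess-unit-target x d k =
    cong₂ (λ a b → + at x (suc k) ℤ.+ (a ℤ.- b)) (unit-self d k) (unit-≢ d ℕ.1+n≢n)

  excess-unit-elsewhere : ∀ x d {k j} → j ≢ k → j ≢ suc k → excess x (unit d k) j ≡ + at x j
  excess-unit-elsewhere x d {k} {j} j≢k j≢1+k =
    trans (cong₂ (λ a b → + at x j ℤ.+ (a ℤ.- b)) (inflow-away j j≢1+k) (unit-≢ d j≢k))
          (ℤ.+-identityʳ (+ at x j))
    where
    inflow-away : ∀ j → j ≢ suc k → inflow (unit d k) j ≡ 0ℤ
    inflow-away zero    _      = refl
    inflow-away (suc j) j≢1+k = unit-≢ d (j≢1+k ∘ cong suc)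

  vanishes-successor : ∀ {j} a → Vanishes j (+ a ℤ.+ 1ℤ ℤ.- + suc a)
  vanishes-successor a = subst (Vanishes _) (sym (cancel (+ a))) vanishes-0
    where
    cancel : ∀ z → z ℤ.+ 1ℤ ℤ.- (1ℤ ℤ.+ z) ≡ 0ℤ
    cancel = solve-∀

  inc-vanishes : ∀ {J a b} → Inc n m J a b → Vanishes (toℕ J) (+ a ℤ.+ 1ℤ ℤ.- + b)
  inc-vanishes {a = a} (inj₁ (_ , inj₁ (_ , refl)))          = vanishes-successor a
  inc-vanishes {a = a} (inj₂ (_ , refl))                     = vanishes-successor a
  inc-vanishes {a = a} (inj₁ (bucket , inj₂ (1+a≡n , refl))) =
    subst (+ n ℤ∣.∣_) n≡a+1 ℤ∣.∣-refl , contradiction bucket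
    where
    n≡a+1 : + n ≡ + a ℤ.+ 1ℤ ℤ.- 0ℤ
    n≡a+1 = trans (cong +_ (sym 1+a≡n)) (trans (ℤ.+-comm 1ℤ (+ a)) (sym (ℤ.+-identityʳ _)))

  inc-vanishes-at : ∀ {J c} (v w : Coords m) → toℕ J ≡ c → Inc n m J (lookup v J) (lookup w J) →
                    Vanishes c (+ at v c ℤ.+ 1ℤ ℤ.- + at w c) ×
                    Vanishes c (+ at w c ℤ.+ -1ℤ ℤ.- + at v c)
  inc-vanishes-at {J} v w refl inc =
    up , subst (Vanishes (toℕ J)) (flip (+ at v (toℕ J)) (+ at w (toℕ J))) (vanishes-neg up)
    where
    up = subst₂ (λ a b → Vanishes (toℕ J) (+ a ℤ.+ 1ℤ ℤ.- + b))
                (lookup≡at v refl) (lookup≡at w refl) (inc-vanishes inc)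
    flip : ∀ a b → ℤ.- (a ℤ.+ 1ℤ ℤ.- b) ≡ b ℤ.+ -1ℤ ℤ.- a
    flip = solve-∀

  shift-others : ∀ {d i x y} → Shift n m d i x y → OthersEq m i x y
  shift-others {left}  (_ , _ , others) = others
  shift-others {right} (_ , _ , others) = others

  shift-unmoved : ∀ {d i x y j} → Shift n m d i x y → j < suc (suc m) →
                  j ≢ toℕ i → j ≢ suc (toℕ i) → at y j ≡ at x j
  shift-unmoved {i = i} {x} {y} {j} s j< j≢k j≢1+k = begin
    at y j       ≡⟨ lookup≡at y J≡j ⟨
    lookup y J   ≡⟨ shift-others s J (λ J≡ → j≢k (trans (sym J≡j) (trans (cong toℕ J≡) (Fin.toℕ-inject₁ i))))
                                     (λ J≡ → j≢1+k (trans (sym J≡j) (cong toℕ J≡))) ⟩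
    lookup x J   ≡⟨ lookup≡at x J≡j ⟩
    at x j       ∎
    where
    open ≡-Reasoning
    J = fromℕ< j<
    J≡j = Fin.toℕ-fromℕ< j<

  shift-vanishes : ∀ {d i x y} → Shift n m d i x y → ∀ j → j < suc (suc m) →
                   Vanishes j (excess x (unit d (toℕ i)) j ℤ.- + at y j)
  shift-vanishes {d} {i} {x} {y} s j j< with j ≟ toℕ i | j ≟ suc (toℕ i)
  ... | yes refl | _ =
    subst (λ e → Vanishes j (e ℤ.- + at y j)) (sym (excess-unit-source x d j)) (source d s)
    where
    source : ∀ d → Shift n m d i x y → Vanishes j (+ at x j ℤ.+ (0ℤ ℤ.- sign d) ℤ.- + at y j)
    source right (inc , _) = proj₂ (inc-vanishes-at y x (Fin.toℕ-inject₁ i) inc)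
    source left  (inc , _) = proj₁ (inc-vanishes-at x y (Fin.toℕ-inject₁ i) inc)
  ... | no _ | yes refl =
    subst (λ e → Vanishes j (e ℤ.- + at y j)) (sym (excess-unit-target x d (toℕ i))) (target d s)
    where
    target : ∀ d → Shift n m d i x y → Vanishes j (+ at x j ℤ.+ (sign d ℤ.- 0ℤ) ℤ.- + at y j)
    target right (_ , inc , _) = proj₁ (inc-vanishes-at x y refl inc)
    target left  (_ , inc , _) = proj₂ (inc-vanishes-at y x refl inc)
  ... | no j≢k | no j≢1+k rewrite excess-unit-elsewhere x d j≢k j≢1+k | shift-unmoved s j< j≢k j≢1+k =
    subst (Vanishes j) (sym (ℤ.+-inverseʳ (+ at x j))) vanishes-0

  inflow-+ : ∀ {F G D} → (∀ k → F k ≡ D k ℤ.+ G k) →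
             ∀ j → inflow F j ≡ inflow D j ℤ.+ inflow G j
  inflow-+ F≡D+G zero    = refl
  inflow-+ F≡D+G (suc j) = F≡D+G j

  excess-split : ∀ x y {F G D} → (∀ k → F k ≡ D k ℤ.+ G k) → ∀ j →
                 excess x F j ℤ.- excess y G j ≡ excess x D j ℤ.- + at y j
  excess-split x y {F} {G} {D} F≡D+G j rewrite inflow-+ F≡D+G j | F≡D+G j =
    regroup (+ at x j) (+ at y j) (inflow D j) (inflow G j) (D j) (G j)
    where
    regroup : ∀ a b iD iG d g →
              a ℤ.+ ((iD ℤ.+ iG) ℤ.- (d ℤ.+ g)) ℤ.- (b ℤ.+ (iG ℤ.- g)) ≡ a ℤ.+ (iD ℤ.- d) ℤ.- b
    regroup = solve-∀

  shift-excess-vanishes : ∀ {d i x y F G} → Shift n m d i x y → (∀ k → F k ≡ unit d (toℕ i) k ℤ.+ G k) →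
                          ∀ j → j < suc (suc m) → Vanishes j (excess x F j ℤ.- excess y G j)
  shift-excess-vanishes {x = x} {y} s F≡ j j< =
    subst (Vanishes j) (sym (excess-split x y F≡ j)) (shift-vanishes s j j<)

  drains-backward : ∀ {d i x y F G} → Shift n m d i x y → (∀ k → F k ≡ unit d (toℕ i) k ℤ.+ G k) →
                    Drains y G → Drains x F
  drains-backward {d} {i} {x} {y} {F} {G} s F≡ (drains Gₘ₊₁≡0 vanish) =
    drains (trans (F≡ (suc m)) (cong₂ ℤ._+_ (unit-beyond d i) Gₘ₊₁≡0))
    λ j j< → subst (Vanishes j) (cancel (excess x F j) (excess y G j))
                   (vanishes-+ (shift-excess-vanishes s F≡ j j<) (vanish j j<))
    where
    cancel : ∀ a b → a ℤ.- b ℤ.+ b ≡ a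
    cancel = solve-∀

  drains-forward : ∀ {d i x y F} → Shift n m d i x y → Drains x F →
                   Drains y (λ k → F k ℤ.- unit d (toℕ i) k)
  drains-forward {d} {i} {x} {y} {F} s (drains Fₘ₊₁≡0 vanish) =
    drains (cong₂ ℤ._-_ Fₘ₊₁≡0 (unit-beyond d i))
    λ j j< → subst (Vanishes j) (cancel (excess x F j) (excess y G j))
                   (vanishes-+ (vanish j j<) (vanishes-neg (shift-excess-vanishes s F≡ j j<)))
    where
    G = λ k → F k ℤ.- unit d (toℕ i) k
    F≡ : ∀ k → F k ≡ unit d (toℕ i) k ℤ.+ G k
    F≡ k = restore (F k) (unit d (toℕ i) k)
      where
      restore : ∀ a u → a ≡ u ℤ.+ (a ℤ.- u)
      restore = solve-∀
    cancel : ∀ a b → a ℤ.+ ℤ.- (a ℤ.- b) ≡ b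
    cancel = solve-∀

  lefts rights shifts : ∀ {x y} → Path n m x y → ℕ → ℕ
  lefts []                   _ = 0
  lefts (step left  i _ _ P) k = ⟦ k ≡ toℕ i ⟧ + lefts P k
  lefts (step right _ _ _ P) k = lefts P k
  rights []                   _ = 0
  rights (step left  _ _ _ P) k = rights P k
  rights (step right i _ _ P) k = ⟦ k ≡ toℕ i ⟧ + rights P k
  shifts P k = lefts P k + rights P k

  flow : ∀ {x y} → Path n m x y → ℕ → ℤ
  flow P k = + rights P k ℤ.- + lefts P k

  flow-step : ∀ {x y z} d i (V : Valid n m y) (s : Shift n m d i x y) (P : Path n m y z) k →
              flow (step d i V s P) k ≡ unit d (toℕ i) k ℤ.+ flow P k
  flow-step left i V s P k = begin
    + r ℤ.- + (u + l)      ≡⟨ cong (ℤ._-_ (+ r)) (ℤ.pos-+ u l) ⟩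
    + r ℤ.- (+ u ℤ.+ + l)  ≡⟨ regroup (+ r) (+ u) (+ l) ⟩
    ℤ.- + u ℤ.+ flow P k   ∎
    where
    open ≡-Reasoning
    r = rights P k
    l = lefts P k
    u = ⟦ k ≡ toℕ i ⟧
    regroup : ∀ r u l → r ℤ.- (u ℤ.+ l) ≡ ℤ.- u ℤ.+ (r ℤ.- l)
    regroup = solve-∀
  flow-step right i V s P k =
    trans (cong (ℤ._- + lefts P k) (ℤ.pos-+ ⟦ k ≡ toℕ i ⟧ (rights P k)))
          (ℤ.+-assoc (+ ⟦ k ≡ toℕ i ⟧) (+ rights P k) (ℤ.- + lefts P k))

  path-drains : ∀ {x} (P : Path n m x (zeroV m)) → Drains x (flow P)
  path-drains []               = drains refl λ j _ → subst (Vanishes j) (sym (origin j)) vanishes-0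
    where
    origin : ∀ j → excess (zeroV m) (flow ([] {x = zeroV m})) j ≡ 0ℤ
    origin zero                                   = refl
    origin (suc j) rewrite at-replicate (suc m) j = refl
  path-drains (step d i V s P) = drains-backward s (flow-step d i V s P) (path-drains P)

  drains-inner : ∀ {x F} → Drains x F → ∀ {t} → t < m → F (suc t) ≡ F t ℤ.+ + at x (suc t)
  drains-inner {x} {F} (drains _ vanish) {t} t<m = begin
    F (suc t)                                      ≡⟨ isolate (+ at x (suc t)) (F t) (F (suc t)) ⟩
    F t ℤ.+ + at x (suc t) ℤ.- excess x F (suc t)  ≡⟨ cong (ℤ._-_ (F t ℤ.+ + at x (suc t))) balanced ⟩
    F t ℤ.+ + at x (suc t) ℤ.- 0ℤ                  ≡⟨ ℤ.+-identityʳ _ ⟩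
    F t ℤ.+ + at x (suc t)                         ∎
    where
    open ≡-Reasoning
    balanced : excess x F (suc t) ≡ 0ℤ
    balanced = proj₂ (vanish (suc t) (s<s (ℕ.m<n⇒m<1+n t<m))) (¬Bucket-suc t<m)
    isolate : ∀ a f g → g ≡ f ℤ.+ a ℤ.- (a ℤ.+ (f ℤ.- g))
    isolate = solve-∀

  drains-monotone : ∀ {x F} → Drains x F → ∀ {a b} → a ≤ b → b ≤ m → F a ℤ.≤ F b
  drains-monotone D {b = zero}  z≤n  _     = ℤ.≤-refl
  drains-monotone {x} {F} D {a} {suc b} a≤1+b 1+b≤m with ℕ.m≤n⇒m<n∨m≡n a≤1+b
  ... | inj₂ refl      = ℤ.≤-refl
  ... | inj₁ (s≤s a≤b) = ℤ.≤-trans (drains-monotone D a≤b (ℕ.<⇒≤ 1+b≤m)) F[b]≤F[1+b]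
    where
    F[b]≤F[1+b] : F b ℤ.≤ F (suc b)
    F[b]≤F[1+b] = subst (F b ℤ.≤_) (sym (drains-inner D 1+b≤m)) (ℤ.i≤i+j (F b) (+ at x (suc b)))

  drains-0⇒zeroV : ∀ {x F} → Bounded x → Drains x F → (∀ k → k ≤ m → F k ≡ 0ℤ) → x ≡ zeroV m
  drains-0⇒zeroV {x} {F} B (drains Fₘ₊₁≡0 vanish) F≡0 =
    at-injective x (zeroV m) λ j j< → trans (empty j j<) (sym (at-replicate (suc (suc m)) j))
    where
    F≡0′ : ∀ k → k ≤ suc m → F k ≡ 0ℤ
    F≡0′ k k≤1+m with ℕ.m≤n⇒m<n∨m≡n k≤1+m
    ... | inj₁ (s≤s k≤m) = F≡0 k k≤m
    ... | inj₂ refl      = Fₘ₊₁≡0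
    inflow≡0 : ∀ j → j < suc (suc m) → inflow F j ≡ 0ℤ
    inflow≡0 zero    _         = refl
    inflow≡0 (suc j) (s<s j<) = F≡0′ j (ℕ.<⇒≤ j<)
    excess≡ : ∀ j → j < suc (suc m) → + at x j ≡ excess x F j
    excess≡ j j< = sym (trans (cong₂ (λ a b → + at x j ℤ.+ (a ℤ.- b)) (inflow≡0 j j<) (F≡0′ j (ℕ.s≤s⁻¹ j<)))
                              (ℤ.+-identityʳ (+ at x j)))
    empty : ∀ j → j < suc (suc m) → at x j ≡ 0
    empty j j< with bucket? j | vanish j j<
    ... | yes b  | n∣e , _  =
      ∣∧<⇒≡0 (ℤ∣.∣⇒∣ᵤ (subst (+ n ℤ∣.∣_) (sym (excess≡ j j<)) n∣e)) (proj₁ (B j j<) b)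
    ... | no  nb | _ , e≡0 = ℤ.+-injective (trans (excess≡ j j<) (e≡0 nb))

  cost : (ℕ → ℤ) → ℕ
  cost F = ∑[ k < suc m ] ∣ F k ∣

  cost≡0⇒flat : ∀ F → cost F ≡ 0 → ∀ k → k ≤ m → F k ≡ 0ℤ
  cost≡0⇒flat F cost≡0 k k≤m =
    ℤ.∣i∣≡0⇒i≡0 (sumℕ≡0⇒ (suc m) (λ k → ∣ F k ∣) cost≡0 k (s≤s k≤m))

  CanGive CanTake : Coords m → ℕ → Set
  CanGive x c = Bucket c ⊎ at x c ≡ 1
  CanTake x c = Bucket c ⊎ at x c ≡ 0

  Movable : Dir → Coords m → ℕ → Set
  Movable right x k = CanGive x k × CanTake x (suc k)
  Movable left  x k = CanTake x k × CanGive x (suc k)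

  Toward : Dir → ℤ → Set
  Toward right z = 0ℤ ℤ.< z
  Toward left  z = z ℤ.< 0ℤ

  module _ {x F} (B : Bounded x) (D : Drains x F) where

    pass-empty : ∀ {t} → t < m → ¬ CanGive x (suc t) → CanTake x (suc t) × F (suc t) ≡ F t
    pass-empty {t} t<m ¬give with ℕ.n≤1⇒n≡0∨n≡1 (proj₂ (B (suc t) (s<s (ℕ.m<n⇒m<1+n t<m))) (¬give ∘ inj₁))
    ... | inj₂ x≡1 = contradiction (inj₂ x≡1) ¬give
    ... | inj₁ x≡0 = inj₂ x≡0 , (begin
      F (suc t)                   ≡⟨ drains-inner D t<m ⟩
      F t ℤ.+ + at x (suc t)      ≡⟨ cong (λ a → F t ℤ.+ + a) x≡0 ⟩
      F t ℤ.+ 0ℤ                  ≡⟨ ℤ.+-identityʳ (F t) ⟩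
      F t                         ∎)
      where open ≡-Reasoning

    movable-right : ∀ p → p ≤ m → 0ℤ ℤ.< F p → CanTake x (suc p) →
                    Σ ℕ λ k → k ≤ m × 0ℤ ℤ.< F k × Movable right x k
    movable-right zero    0≤m   pos take = 0 , 0≤m , pos , inj₁ (inj₁ refl) , take
    movable-right (suc p) 1+p≤m pos take with bucket? (suc p) ⊎-dec at x (suc p) ≟ 1
    ... | yes give = suc p , 1+p≤m , pos , give , take
    ... | no ¬give with pass-empty 1+p≤m ¬give
    ...   | take′ , F≡ = movable-right p (ℕ.<⇒≤ 1+p≤m) (subst (0ℤ ℤ.<_) F≡ pos) take′

    movable-left : ∀ r p → r + p ≡ m → F p ℤ.< 0ℤ → CanTake x p →
                   Σ ℕ λ k → k ≤ m × F k ℤ.< 0ℤ × Movable left x k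
    movable-left r p r+p≡m neg take with bucket? (suc p) ⊎-dec at x (suc p) ≟ 1
    ... | yes give = p , subst (p ≤_) r+p≡m (ℕ.m≤n+m p r) , neg , take , give
    movable-left zero    p refl   neg take | no ¬give = contradiction (inj₁ (inj₂ refl)) ¬give
    movable-left (suc r) p 1+r+p≡m neg take | no ¬give
      with pass-empty (subst (suc p ≤_) 1+r+p≡m (s≤s (ℕ.m≤n+m p r))) ¬give
    ... | take′ , F≡ =
      movable-left r (suc p) (trans (ℕ.+-suc r p) 1+r+p≡m) (subst (ℤ._< 0ℤ) (sym F≡) neg) take′

    -- A draining flow is monotone, so if it is neither positive at m nor negative at 0 it is zero.
    movable : cost F ≢ 0 → Σ Dir λ d → Σ ℕ λ k → k ≤ m × Toward d (F k) × Movable d x k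
    movable cost≢0 with 0ℤ ℤ.<? F m | F 0 ℤ.<? 0ℤ
    ... | yes pos | _       = right , movable-right m ℕ.≤-refl pos (inj₁ (inj₂ refl))
    ... | no _    | yes neg = left , movable-left m 0 (ℕ.+-identityʳ m) neg (inj₁ (inj₁ refl))
    ... | no ¬pos | no ¬neg = contradiction cost≡0 cost≢0
      where
      flat : ∀ k → k ≤ m → F k ≡ 0ℤ
      flat k k≤m = ℤ.≤-antisym (ℤ.≤-trans (drains-monotone D k≤m ℕ.≤-refl) (ℤ.≮⇒≥ ¬pos))
                               (ℤ.≤-trans (ℤ.≮⇒≥ ¬neg) (drains-monotone D z≤n k≤m))
      cost≡0 : cost F ≡ 0
      cost≡0 = trans (sumℕ-cong (suc m) (λ k k< → cong ∣_∣ (flat k (ℕ.s≤s⁻¹ k<))))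
                     (sumℕ-zero (suc m))

  IncAt : ℕ → ℕ → ℕ → Set
  IncAt c a b = (Bucket c × IncMod n a b) ⊎ (¬ Bucket c × b ≡ suc a)

  increment : ∀ {c a} → InRange c a → Bucket c ⊎ a ≡ 0 → Σ ℕ λ b → IncAt c a b × InRange c b
  increment {c} {a} (a<n , _) take with bucket? c
  ... | yes b with suc a ≟ n
  ...   | yes 1+a≡n = 0 , inj₁ (b , inj₂ (1+a≡n , refl)) , (λ _ → z<s) , contradiction b
  ...   | no  1+a≢n = suc a , inj₁ (b , inj₁ (1+a<n , refl)) , (λ _ → 1+a<n) , contradiction b
    where 1+a<n = ℕ.≤∧≢⇒< (a<n b) 1+a≢n
  increment (_ , _) (inj₁ b)    | no nb = contradiction b nb
  increment (_ , _) (inj₂ refl) | no nb =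
    1 , inj₂ (nb , refl) , (λ b → contradiction b nb) , (λ _ → ℕ.≤-refl)

  decrement : ∀ {c a} → InRange c a → Bucket c ⊎ a ≡ 1 → Σ ℕ λ b → IncAt c b a × InRange c b
  decrement {c} {a} (a<n , _) give with bucket? c
  decrement {a = zero}  _ _ | yes b =
    n′ , inj₁ (b , inj₂ (refl , refl)) , (λ _ → ℕ.≤-refl) , contradiction b
  decrement {a = suc a} (a<n , _) _ | yes b =
    a , inj₁ (b , inj₁ (a<n b , refl)) , (λ _ → ℕ.<-trans (ℕ.n<1+n a) (a<n b)) , contradiction b
  decrement (_ , _) (inj₁ b)    | no nb = contradiction b nb
  decrement (_ , _) (inj₂ refl) | no nb = 0 , inj₂ (nb , refl) , (λ b → contradiction b nb) , (λ _ → z≤n)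

  incAt⇒inc : ∀ {J c a b} (v w : Coords m) → toℕ J ≡ c → at v c ≡ a → at w c ≡ b → IncAt c a b →
              Inc n m J (lookup v J) (lookup w J)
  incAt⇒inc {J} v w refl refl refl =
    subst₂ (IncAt (toℕ J)) (sym (lookup≡at v refl)) (sym (lookup≡at w refl))

  module Shifted (x : Coords m) {k} (k<1+m : k < suc m) (a b : ℕ) where

    i : Fin (suc m)
    i = fromℕ< k<1+m

    y : Coords m
    y = setAt (setAt x k a) (suc k) b

    source≡ : toℕ (inject₁ i) ≡ k
    source≡ = trans (Fin.toℕ-inject₁ i) (Fin.toℕ-fromℕ< k<1+m)

    target≡ : toℕ (fsuc i) ≡ suc k
    target≡ = cong suc (Fin.toℕ-fromℕ< k<1+m)

    y-source : at y k ≡ a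
    y-source = trans (at-setAt-≢ (setAt x k a) b (ℕ.1+n≢n ∘ sym)) (at-setAt-≡ x a (ℕ.m<n⇒m<1+n k<1+m))

    y-target : at y (suc k) ≡ b
    y-target = at-setAt-≡ (setAt x k a) b (s<s k<1+m)

    y-elsewhere : ∀ {j} → j ≢ k → j ≢ suc k → at y j ≡ at x j
    y-elsewhere j≢k j≢1+k = trans (at-setAt-≢ (setAt x k a) b j≢1+k) (at-setAt-≢ x a j≢k)

    others : OthersEq m i x y
    others J J≢source J≢target = begin
      lookup y J       ≡⟨ lookup≡at y refl ⟩
      at y (toℕ J)     ≡⟨ y-elsewhere (J≢source ∘ toℕ-≡ source≡) (J≢target ∘ toℕ-≡ target≡) ⟩
      at x (toℕ J)     ≡⟨ lookup≡at x refl ⟨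
      lookup x J       ∎
      where
      open ≡-Reasoning
      toℕ-≡ : ∀ {I : Fin (suc (suc m))} {c} → toℕ I ≡ c → toℕ J ≡ c → J ≡ I
      toℕ-≡ I≡c J≡c = Fin.toℕ-injective (trans J≡c (sym I≡c))

    shift-right : IncAt k a (at x k) → IncAt (suc k) (at x (suc k)) b → Shift n m right i x y
    shift-right inc inc′ =
      incAt⇒inc y x source≡ y-source refl inc , incAt⇒inc x y target≡ refl y-target inc′ , others

    shift-left : IncAt k (at x k) a → IncAt (suc k) b (at x (suc k)) → Shift n m left i x y
    shift-left inc inc′ =
      incAt⇒inc x y source≡ refl y-source inc , incAt⇒inc y x target≡ y-target refl inc′ , others

    bounded : Bounded x → InRange k a → InRange (suc k) b → Bounded y
    bounded B a∈ b∈ c c< with c ≟ k | c ≟ suc k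
    ... | yes refl | _        = subst (InRange c) (sym y-source) a∈
    ... | no _     | yes refl = subst (InRange c) (sym y-target) b∈
    ... | no c≢k   | no c≢1+k = subst (InRange c) (sym (y-elsewhere c≢k c≢1+k)) (B c c<)

  shift-movable : ∀ {x} → Bounded x → ∀ d {k} (k≤m : k ≤ m) → Movable d x k →
                  Σ (Coords m) λ y → Shift n m d (fromℕ< (s≤s k≤m)) x y × Bounded y
  shift-movable {x} B right {k} k≤m (give , take)
    with decrement (B k (s≤s (ℕ.m≤n⇒m≤1+n k≤m))) give | increment (B (suc k) (s≤s (s≤s k≤m))) take
  ... | a , inc , a∈ | b , inc′ , b∈ = y , shift-right inc inc′ , bounded B a∈ b∈
    where open Shifted x (s≤s k≤m) a b
  shift-movable {x} B left {k} k≤m (take , give)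
    with increment (B k (s≤s (ℕ.m≤n⇒m≤1+n k≤m))) take | decrement (B (suc k) (s≤s (s≤s k≤m))) give
  ... | a , inc , a∈ | b , inc′ , b∈ = y , shift-left inc inc′ , bounded B a∈ b∈
    where open Shifted x (s≤s k≤m) a b

  toward-abs : ∀ d z → Toward d z → suc ∣ z ℤ.- sign d ∣ ≡ ∣ z ∣
  toward-abs right +[1+ _ ]     _            = refl
  toward-abs right (+ zero)     (ℤ.+<+ ())
  toward-abs left  -[1+ zero ]  _            = refl
  toward-abs left  -[1+ suc _ ] _            = refl
  toward-abs left  (+ _)        (ℤ.+<+ ())

  cost-shift : ∀ F d (i : Fin (suc m)) → Toward d (F (toℕ i)) →
               suc (cost (λ j → F j ℤ.- unit d (toℕ i) j)) ≡ cost F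
  cost-shift F d i toward = ℕ.+-cancelʳ-≡ ∣ G k ∣ _ _ (begin
    suc (cost G) + ∣ G k ∣  ≡⟨ ℕ.+-suc (cost G) ∣ G k ∣ ⟨
    cost G + suc ∣ G k ∣    ≡⟨ cong (_+_ (cost G)) one-less ⟩
    cost G + ∣ F k ∣        ≡⟨ sumℕ-update (suc m) (∣_∣ ∘ F) (∣_∣ ∘ G) (Fin.toℕ<n i) unchanged ⟩
    cost F + ∣ G k ∣        ∎)
    where
    open ≡-Reasoning
    k = toℕ i
    G = λ j → F j ℤ.- unit d k j
    one-less : suc ∣ G k ∣ ≡ ∣ F k ∣
    one-less = trans (cong (λ u → suc ∣ F k ℤ.- u ∣) (unit-self d k)) (toward-abs d (F k) toward)
    unchanged : ∀ j → j ≢ k → ∣ G j ∣ ≡ ∣ F j ∣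
    unchanged j j≢k = cong ∣_∣ (trans (cong (ℤ._-_ (F j)) (unit-≢ d j≢k)) (ℤ.+-identityʳ (F j)))

  path-of-cost : ∀ N {x F} → cost F ≡ N → Bounded x → Drains x F →
                 Σ (Path n m x (zeroV m)) λ Q → len Q ≡ N
  path-of-cost zero {F = F} cost≡0 B D with drains-0⇒zeroV B D (cost≡0⇒flat F cost≡0)
  ... | refl = [] , refl
  path-of-cost (suc N) {x} {F} cost≡1+N B D with movable B D (ℕ.1+n≢0 ∘ trans (sym cost≡1+N))
  ... | d , k , k≤m , toward , mov with shift-movable B d k≤m mov
  ...   | y , s , By = let Q , len≡N = path-of-cost N cost≡N By Dy in step d i Vy s Q , cong suc len≡N
    where
    i = fromℕ< (s≤s k≤m)
    Dy = drains-forward s D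
    Vy = bounded⇒valid {y} By (drains⇒divisible Dy)
    toward′ = subst (Toward d ∘ F) (sym (Fin.toℕ-fromℕ< (s≤s k≤m))) toward
    cost≡N = ℕ.suc-injective (trans (cost-shift F d i toward′) cost≡1+N)

  shifts-step : ∀ {x y z} d i (V : Valid n m y) (s : Shift n m d i x y) (P : Path n m y z) k →
                shifts (step d i V s P) k ≡ ⟦ k ≡ toℕ i ⟧ + shifts P k
  shifts-step left  i V s P k = ℕ.+-assoc ⟦ k ≡ toℕ i ⟧ (lefts P k) (rights P k)
  shifts-step right i V s P k = swap (lefts P k) ⟦ k ≡ toℕ i ⟧ (rights P k)
    where
    swap : ∀ a b c → a + (b + c) ≡ b + (a + c)
    swap = ℕ-Solver.solve-∀

  len≡∑shifts : ∀ {x y} (P : Path n m x y) → len P ≡ ∑[ k < suc m ] shifts P k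
  len≡∑shifts []               = sym (sumℕ-zero (suc m))
  len≡∑shifts (step d i V s P) = begin
    suc (len P)
      ≡⟨ cong₂ _+_ (sym (sumℕ-⟦≡⟧ (suc m) (Fin.toℕ<n i))) (len≡∑shifts P) ⟩
    ∑[ k < suc m ] ⟦ k ≡ toℕ i ⟧ + ∑[ k < suc m ] shifts P k
      ≡⟨ sumℕ-+ (suc m) (λ k → ⟦ k ≡ toℕ i ⟧) (shifts P) ⟨
    ∑[ k < suc m ] (⟦ k ≡ toℕ i ⟧ + shifts P k)
      ≡⟨ sumℕ-cong (suc m) (λ k _ → shifts-step d i V s P k) ⟨
    ∑[ k < suc m ] shifts (step d i V s P) k
      ∎
    where open ≡-Reasoning

  ∣flow∣≤shifts : ∀ {x y} (P : Path n m x y) k → ∣ flow P k ∣ ≤ shifts P k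
  ∣flow∣≤shifts P k = ∣r-l∣≤l+r (rights P k) (lefts P k)

  geodesic-one-way : ∀ {v} → Valid n m v → (P : Path n m v (zeroV m)) → Geodesic P →
                     ∀ k → k < suc m → lefts P k ≡ 0 ⊎ rights P k ≡ 0
  geodesic-one-way {v} V P geodesic k k< with lefts P k ≟ 0 | rights P k ≟ 0
  ... | yes lefts≡0 | _            = inj₁ lefts≡0
  ... | no _        | yes rights≡0 = inj₂ rights≡0
  ... | no lefts≢0  | no rights≢0  = contradiction (geodesic Q) (ℕ.<⇒≱ shorter)
    where
    shortest = path-of-cost _ refl (valid⇒bounded {v} V) (path-drains P)
    Q = proj₁ shortest
    shorter : len Q < len P
    shorter = begin-strict
      len Q                      ≡⟨ proj₂ shortest ⟩
      cost (flow P)              <⟨ sumℕ-mono-< (suc m) (λ j _ → ∣flow∣≤shifts P j) k<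
                                      (∣r-l∣<l+r (ℕ.n≢0⇒n>0 rights≢0) (ℕ.n≢0⇒n>0 lefts≢0)) ⟩
      ∑[ j < suc m ] shifts P j  ≡⟨ len≡∑shifts P ⟨
      len P                      ∎
      where open ℕ.≤-Reasoning

  NoShift : Dir → ℕ → Dir × Fin (suc m) → Set
  NoShift d k (d′ , i) = d′ ≡ d → toℕ i ≢ k

  no-lefts : ∀ {x y} (P : Path n m x y) {k} → lefts P k ≡ 0 → All (NoShift left k) (labels P)
  no-lefts []                   _        = []
  no-lefts (step left  i _ _ P) lefts≡0 =
    (λ _ → ⟦≡⟧≡0⇒≢ (ℕ.m+n≡0⇒m≡0 _ lefts≡0) ∘ sym) ∷ no-lefts P (ℕ.m+n≡0⇒n≡0 _ lefts≡0)
  no-lefts (step right i _ _ P) lefts≡0 = (λ ()) ∷ no-lefts P lefts≡0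

  no-rights : ∀ {x y} (P : Path n m x y) {k} → rights P k ≡ 0 → All (NoShift right k) (labels P)
  no-rights []                   _         = []
  no-rights (step left  i _ _ P) rights≡0 = (λ ()) ∷ no-rights P rights≡0
  no-rights (step right i _ _ P) rights≡0 =
    (λ _ → ⟦≡⟧≡0⇒≢ (ℕ.m+n≡0⇒m≡0 _ rights≡0) ∘ sym) ∷ no-rights P (ℕ.m+n≡0⇒n≡0 _ rights≡0)

  inner-wall : ∀ {x y} (P : Path n m x y) p → shifts P (toℕ p) ≡ 0 → InnerWall P p
  inner-wall P p shifts≡0 =
    All.zipWith untouched (no-lefts P (ℕ.m+n≡0⇒m≡0 _ shifts≡0) , no-rights P (ℕ.m+n≡0⇒n≡0 _ shifts≡0))
    where
    untouched : ∀ {s} → NoShift left (toℕ p) s × NoShift right (toℕ p) s → proj₂ s ≢ p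
    untouched {left  , i} (noL , _) refl = noL refl refl
    untouched {right , i} (_ , noR) refl = noR refl refl

  lower-wall : ∀ {x y} (P : Path n m x y) → lefts P 0 ≡ 0 → LowerWall P
  lower-wall P lefts≡0 = All.map (λ { noL (refl , refl) → noL refl refl }) (no-lefts P lefts≡0)

  upper-wall : ∀ {x y} (P : Path n m x y) → rights P m ≡ 0 → UpperWall P
  upper-wall P rights≡0 =
    All.map (λ { noR (refl , refl) → noR refl (Fin.toℕ-fromℕ m) }) (no-rights P rights≡0)

  OneWay : ∀ {x y} → Path n m x y → Set
  OneWay P = ∀ k → k < suc m → lefts P k ≡ 0 ⊎ rights P k ≡ 0

  -- Nothing enters the inner coordinate k+1 when rights P k ≡ 0 ≡ lefts P (suc k), yet the
  -- left shifts at k and the right shifts at k+1 all take a unit from it.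
  one-way-rightless : ∀ {v} → Valid n m v → (P : Path n m v (zeroV m)) → OneWay P →
                      (∀ k → k < suc m → shifts P k ≢ 0) → lefts P 0 ≢ 0 →
                      ∀ k → k ≤ m → rights P k ≡ 0
  one-way-rightless V P one-way busy lefts₀≢0 zero _ with one-way 0 z<s
  ... | inj₁ lefts≡0  = contradiction lefts≡0 lefts₀≢0
  ... | inj₂ rights≡0 = rights≡0
  one-way-rightless {v} V P one-way busy lefts₀≢0 (suc k) 1+k≤m with one-way (suc k) (s≤s 1+k≤m)
  ... | inj₂ rights≡0 = rights≡0
  ... | inj₁ lefts≡0  =
    contradiction (subst (_≤ 1) (sym carried) v[1+k]≤1) (ℕ.<⇒≱ (ℕ.+-mono-≤ rights>0 lefts>0))
    where
    rights[k]≡0 : rights P k ≡ 0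
    rights[k]≡0 = one-way-rightless V P one-way busy lefts₀≢0 k (ℕ.<⇒≤ 1+k≤m)
    rights>0 : 0 < rights P (suc k)
    rights>0 = ℕ.n≢0⇒n>0 (busy (suc k) (s≤s 1+k≤m) ∘ cong₂ _+_ lefts≡0)
    lefts>0 : 0 < lefts P k
    lefts>0 = ℕ.n≢0⇒n>0 (λ lefts≡0 → busy k (s≤s (ℕ.<⇒≤ 1+k≤m)) (cong₂ _+_ lefts≡0 rights[k]≡0))
    v[1+k]≤1 : at v (suc k) ≤ 1
    v[1+k]≤1 = proj₂ (valid⇒bounded {v} V (suc k) (s≤s (ℕ.m≤n⇒m≤1+n 1+k≤m))) (¬Bucket-suc 1+k≤m)
    carried : rights P (suc k) + lefts P k ≡ at v (suc k)
    carried = +r≡-l+c⇒r+l≡c (rights P (suc k)) (lefts P k) (at v (suc k))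
      (subst₂ (λ a b → + rights P (suc k) ℤ.- + a ≡ + b ℤ.- + lefts P k ℤ.+ + at v (suc k))
              lefts≡0 rights[k]≡0 (drains-inner (path-drains P) 1+k≤m))

  geodesic-has-wall : ∀ {v} → Valid n m v → (P : Path n m v (zeroV m)) → Geodesic P → HasWall P
  geodesic-has-wall V P geodesic with ℕ.anyUpTo? (λ k → shifts P k ≟ 0) (suc m)
  ... | yes (k , k< , idle) =
    inj₁ (fromℕ< k< , inner-wall P _ (trans (cong (shifts P) (Fin.toℕ-fromℕ< k<)) idle))
  ... | no  noneIdle with lefts P 0 ≟ 0
  ...   | yes lefts≡0 = inj₂ (inj₁ (lower-wall P lefts≡0))
  ...   | no  lefts≢0 =
    inj₂ (inj₂ (upper-wall P (one-way-rightless V P (geodesic-one-way V P geodesic) busy lefts≢0 m ℕ.≤-refl)))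
    where
    busy : ∀ k → k < suc m → shifts P k ≢ 0
    busy k k< idle = noneIdle (k , k< , idle)

lemma4p7 : (n m : ℕ) → 1 ≤ n → (v : Coords m) → Valid n m v →
    (P : Path n m v (zeroV m)) → Geodesic P → HasWall P
lemma4p7 zero     m ()
lemma4p7 (suc n′) m _ v V P geodesic = Yoke.geodesic-has-wall n′ m V P geodesic
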